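{- Let $f$ be a non-square positive integer whose simple continued fraction expansion $\sqrt f=[\,a_0;a_1,a_2,\dots]$ has period of even length $2m$ with $2m\equiv 2\pmod 4$, and let $(c,h)$ be the smallest pair of positive integers with $c^2-fh^2=1$. Then $$hA_{m-1}-(c-1)B_{m-1}=0.$$
   Context: $A_i/B_i$ is the $i$-th convergent $[\,a_0;a_1,\dots,a_i\,]$ of $\sqrt f$, given by $A_i=a_iA_{i-1}+A_{i-2}$, $B_i=a_iB_{i-1}+B_{i-2}$ for $i\ge0$, with $A_{ -1}=B_{ -2}=1$, $A_{ -2}=B_{ -1}=0$. -}

module Defs where

open import Data.Nat using (ℕ; zero; suc; _+_; _*_; _∸_; _/_; _≤_; _≤ᵇ_)
open import Data.Bool using (if_then_else_)
open import Data.Product using (_×_; _,_; proj₁; proj₂)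
open import Relation.Binary.PropositionalEquality using (_≡_)
open import Relation.Nullary using (¬_)

isqrtFrom : ℕ → ℕ → ℕ
isqrtFrom f zero    = zero
isqrtFrom f (suc r) = if suc r * suc r ≤ᵇ f then suc r else isqrtFrom f r

isqrt : ℕ → ℕ
isqrt f = isqrtFrom f f

-- total division (n / 0 := 0); only used with nonzero divisors
_div_ : ℕ → ℕ → ℕ
n div zero    = zero
n div (suc d) = n / suc d

NonSquare : ℕ → Set
NonSquare f = ∀ k → ¬ (k * k ≡ f)

-- Complete quotients of √f: x_k = (P_k + √f) / Q_k, with (P_0, Q_0) = (0, 1),
-- P_{k+1} = a_k Q_k - P_k,  Q_{k+1} = (f - P_{k+1}^2) / Q_k,
-- and partial quotient a_k = ⌊x_k⌋ = ⌊(P_k + ⌊√f⌋) / Q_k⌋.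
mutual
  PQ : ℕ → ℕ → ℕ × ℕ
  PQ f zero    = 0 , 1
  PQ f (suc k) =
    let P = proj₁ (PQ f k) ; Q = proj₂ (PQ f k)
        P' = cfA f k * Q ∸ P
    in P' , ((f ∸ P' * P') div Q)

  cfA : ℕ → ℕ → ℕ
  cfA f k = (proj₁ (PQ f k) + isqrt f) div proj₂ (PQ f k)

IsPeriod : ℕ → ℕ → Set
IsPeriod f L = 1 ≤ L × (∀ k → 1 ≤ k → cfA f (k + L) ≡ cfA f k)

PeriodLength : ℕ → ℕ → Set
PeriodLength f L = IsPeriod f L × (∀ L' → IsPeriod f L' → L ≤ L')

-- Shifted sequences: Aₛ f n = A_{n-2}, Bₛ f n = B_{n-2}
Aₛ : ℕ → ℕ → ℕ
Aₛ f zero = 0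
Aₛ f (suc zero) = 1
Aₛ f (suc (suc n)) = cfA f n * Aₛ f (suc n) + Aₛ f n

Bₛ : ℕ → ℕ → ℕ
Bₛ f zero = 1
Bₛ f (suc zero) = 0
Bₛ f (suc (suc n)) = cfA f n * Bₛ f (suc n) + Bₛ f n

convA : ℕ → ℕ → ℕ
convA f i = Aₛ f (suc (suc i))

convB : ℕ → ℕ → ℕ
convB f i = Bₛ f (suc (suc i))

PellSol : ℕ → ℕ → ℕ → Set
PellSol f c h = 1 ≤ c × 1 ≤ h × c * c ≡ f * (h * h) + 1

FundamentalSol : ℕ → ℕ → ℕ → Set
FundamentalSol f c h = PellSol f c h × (∀ c' h' → PellSol f c' h' → c ≤ c' × h ≤ h')

module Submission where

-- Notation: r = ⌊√f⌋, x_k = (P_k + √f) / Q_k the complete quotients of √f,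
-- a_k = ⌊x_k⌋, and A_k / B_k the convergents (Defs stores them shifted by two:
-- Aₛ f (k + 2) = A_k).  The period is L = 2m with m odd.
--
-- 1. Reduction.  For non-square f every (P_k, Q_k) is reduced: 1 ≤ Q_k, P_k ≤ r,
--    Q_k ≤ P_k + r, Q_k Q_{k+1} + P_{k+1}² = f and P_k + P_{k+1} = a_k Q_k.
-- 2. Norm identity.  Q_k · N(u A_{k-1} + v A_{k-2}, u B_{k-1} + v B_{k-2})
--    = (-1)^k ((Q_k u - P_k v)² - f v²), where N(x, y) = x² - f y².
-- 3. Legendre.  A descent driven by 2. shows that every positive Pell solution is
--    (A_{K-1}, B_{K-1}) for some K ≥ 1 with Q_K = 1; such a K is a period.
-- 4. Periodicity.  If L is a period of the a_k, then x_1 and x_{L+1} are fixed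
--    points of the same Möbius map, whence (P_{L+1}, Q_{L+1}) = (P_1, Q_1), so
--    Q_L = 1, P_L = r and Q_{L-1} = Q_1; for even L, (A_{L-1}, B_{L-1}) solves Pell.
-- 5. Symmetry.  Then a_i = a_{L-i}, which splits A_{L-1}, B_{L-1} as continuants
--    around the middle index m.  With minimality (monotonicity of convergents and
--    L ≤ K) this gives c = A_{L-1}, h = B_{L-1}, and the determinant formula
--    A_{m-1} B_{m-2} - A_{m-2} B_{m-1} = (-1)^m = -1 turns the split into the claim.

open import Defs
open import Data.Nat as ℕ using (ℕ; zero; suc)
open import Data.Product using (_,_)

module IntegerSqrt where
  open import Data.Nat
  open import Data.Nat.Properties
  open import Data.Bool using (true; false; T)
  open import Relation.Binary.PropositionalEquality
  open import Relation.Nullary using (yes; no)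
  open import Data.Empty using (⊥-elim)

  isqrtFrom-sq : ∀ f n → isqrtFrom f n * isqrtFrom f n ≤ f
  isqrtFrom-sq f zero = z≤n
  isqrtFrom-sq f (suc n) with suc n * suc n ≤ᵇ f in eq
  ... | true  = ≤ᵇ⇒≤ (suc n * suc n) f (subst T (sym eq) _)
  ... | false = isqrtFrom-sq f n

  isqrtFrom-max : ∀ f n s → s ≤ n → s * s ≤ f → s ≤ isqrtFrom f n
  isqrtFrom-max f zero s s≤n _ = s≤n
  isqrtFrom-max f (suc n) s s≤n s²≤f with suc n * suc n ≤ᵇ f in eq
  ... | true = s≤n
  ... | false with s ≟ suc n
  ...   | yes refl = ⊥-elim (subst T eq (≤⇒≤ᵇ s²≤f))
  ...   | no s≢ = isqrtFrom-max f n s (≤-pred (≤∧≢⇒< s≤n s≢)) s²≤f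

  isqrt-sq : ∀ f → isqrt f * isqrt f ≤ f
  isqrt-sq f = isqrtFrom-sq f f

  isqrt-lt : ∀ f → f < suc (isqrt f) * suc (isqrt f)
  isqrt-lt f = ≰⇒> λ le → <-irrefl refl (isqrtFrom-max f f (suc (isqrt f)) (s≤f le) le)
    where
    s≤f : suc (isqrt f) * suc (isqrt f) ≤ f → suc (isqrt f) ≤ f
    s≤f = ≤-trans (m≤m*n (suc (isqrt f)) (suc (isqrt f)))

  isqrt-pos : ∀ f → 1 ≤ f → 1 ≤ isqrt f
  isqrt-pos f 1≤f = isqrtFrom-max f f 1 1≤f 1≤f

module Arithmetic where
  open import Data.Nat
  open import Data.Nat.Properties
  open import Data.Nat.DivMod using (m≡m%n+[m/n]*n; m%n<n; m*n/n≡m; m/n*n≤m; m*n%n≡0)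
  open import Data.Product using (∃; _,_)
  open import Data.Sum using (_⊎_; inj₁; inj₂)
  open import Data.Empty using (⊥; ⊥-elim)
  open import Relation.Binary.PropositionalEquality
  open import Relation.Binary.Definitions using (tri<; tri≈; tri>)
  open import Data.Nat.Tactic.RingSolver using (solve-∀)

  div-floor-≤ : ∀ n Q → 1 ≤ Q → n div Q * Q ≤ n
  div-floor-≤ n (suc q) _ = m/n*n≤m n (suc q)

  div-floor-> : ∀ n Q → 1 ≤ Q → n < n div Q * Q + Q
  div-floor-> n (suc q) _ = begin-strict
      n                              ≡⟨ m≡m%n+[m/n]*n n (suc q) ⟩
      n % suc q + n / suc q * suc q  <⟨ +-monoˡ-< (n / suc q * suc q) (m%n<n n (suc q)) ⟩
      suc q + n / suc q * suc q      ≡⟨ +-comm (suc q) (n / suc q * suc q) ⟩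
      n / suc q * suc q + suc q      ∎
    where open ≤-Reasoning

  div-exact : ∀ d Q → 1 ≤ Q → (Q * d) div Q ≡ d
  div-exact d (suc q) _ = trans (cong (_/ suc q) (*-comm (suc q) d)) (m*n/n≡m d (suc q))

  div-unique : ∀ n Q a → 1 ≤ Q → a * Q ≤ n → n < a * Q + Q → n div Q ≡ a
  div-unique n Q a 1≤Q aQ≤n n<aQ+Q with <-cmp (n div Q) a
  ... | tri≈ _ e _ = e
  ... | tri< lt _ _ = ⊥-elim (<-irrefl refl (<-≤-trans (div-floor-> n Q 1≤Q)
          (≤-trans (≤-reflexive (+-comm (n div Q * Q) Q)) (≤-trans (*-monoˡ-≤ Q lt) aQ≤n))))
  ... | tri> _ _ gt = ⊥-elim (<-irrefl refl (<-≤-trans n<aQ+Q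
          (≤-trans (≤-reflexive (+-comm (a * Q) Q)) (≤-trans (*-monoˡ-≤ Q gt) (div-floor-≤ n Q 1≤Q)))))

  square-injective : ∀ a b → a * a ≡ b * b → a ≡ b
  square-injective a b e with <-cmp a b
  ... | tri< lt _ _ = ⊥-elim (<-irrefl e (*-mono-< lt lt))
  ... | tri≈ _ eq _ = eq
  ... | tri> _ _ gt = ⊥-elim (<-irrefl (sym e) (*-mono-< gt gt))

  cancel-*ʳ : ∀ a b c → 1 ≤ c → a * c ≡ b * c → a ≡ b
  cancel-*ʳ a b (suc c) _ e = *-cancelʳ-≡ a b (suc c) e

  even-or-odd : ∀ m → (∃ λ n → m ≡ n + n) ⊎ (∃ λ n → m ≡ suc (n + n))
  even-or-odd zero = inj₁ (0 , refl)
  even-or-odd (suc m) with even-or-odd m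
  ... | inj₁ (n , e) = inj₂ (n , cong suc e)
  ... | inj₂ (n , e) = inj₁ (suc n , cong suc (trans e (sym (+-suc n n))))

  odd-half : ∀ m → (2 * m) % 4 ≡ 2 → ∃ λ n → m ≡ suc (n + n)
  odd-half m e with even-or-odd m
  ... | inj₂ odd = odd
  ... | inj₁ (n , refl) = ⊥-elim (0≢2 (trans (sym (m*n%n≡0 n 4)) (trans (cong (_% 4) (four n)) e)))
    where
    four : ∀ n → n * 4 ≡ 2 * (n + n)
    four = solve-∀
    0≢2 : 0 ≡ 2 → ⊥
    0≢2 ()

  split-identity : ∀ b A B A₀ B₀ c h → c ≡ b * A + B * A₀ → h ≡ b * B + B * B₀ → A₀ * B ≡ A * B₀ + 1 →
                   h * A ≡ (c ∸ 1) * B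
  split-identity b A B A₀ B₀ c h refl refl det = sym (begin
      (c ∸ 1) * B                     ≡⟨ *-distribʳ-∸ B c 1 ⟩
      c * B ∸ 1 * B                   ≡⟨ cong₂ _∸_ cB (*-identityˡ B) ⟩
      h * A + B ∸ B                   ≡⟨ m+n∸n≡m (h * A) B ⟩
      h * A                           ∎)
    where
    open ≡-Reasoning
    l₁ : ∀ b A B A₀ → (b * A + B * A₀) * B ≡ b * A * B + B * (A₀ * B)
    l₁ = solve-∀
    l₂ : ∀ b A B B₀ → b * A * B + B * (A * B₀ + 1) ≡ (b * B + B * B₀) * A + B
    l₂ = solve-∀
    cB : (b * A + B * A₀) * B ≡ (b * B + B * B₀) * A + B
    cB = trans (l₁ b A B A₀) (trans (cong (λ z → b * A * B + B * z) det) (l₂ b A B B₀))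

  -- The two bounds keeping a step of the √f-algorithm reduced.  Here r = ⌊√f⌋ and
  -- Q Q' + P'² = f.  First: if Q ≤ P' + r then P' + Q' exceeds r.
  root<sum : ∀ r f Q Q' P' → r * r < f → Q * Q' + P' * P' ≡ f → Q ≤ P' + r → r < P' + Q'
  root<sum r f Q Q' P' r²<f norm Q≤P'+r = ≰⇒> sum≤r
    where
    sum≤r : P' + Q' ≤ r → ⊥
    sum≤r P'+Q'≤r with m≤n⇒∃[o]m+o≡n Q≤P'+r | m≤n⇒∃[o]m+o≡n P'+Q'≤r
    ... | d , eQ | e , refl = <-irrefl refl (<-≤-trans r²<f (≤-trans (m≤m+n f _) (≤-reflexive (sym expand))))
      where
      open ≡-Reasoning
      rest = Q' * d + e * (e + Q' + 2 * P')
      expand : (P' + Q' + e) * (P' + Q' + e) ≡ f + rest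
      expand = begin
          (P' + Q' + e) * (P' + Q' + e)                             ≡⟨ l₁ P' Q' e ⟩
          Q' * (P' + (P' + Q' + e)) + P' * P' + e * (e + Q' + 2 * P') ≡⟨ cong (λ z → Q' * z + P' * P' + e * (e + Q' + 2 * P')) (sym eQ) ⟩
          Q' * (Q + d) + P' * P' + e * (e + Q' + 2 * P')             ≡⟨ l₂ Q Q' P' d e ⟩
          (Q * Q' + P' * P') + rest                                  ≡⟨ cong (_+ rest) norm ⟩
          f + rest                                                   ∎
        where
        l₁ : ∀ P' Q' e → (P' + Q' + e) * (P' + Q' + e) ≡ Q' * (P' + (P' + Q' + e)) + P' * P' + e * (e + Q' + 2 * P')
        l₁ = solve-∀
        l₂ : ∀ Q Q' P' d e → Q' * (Q + d) + P' * P' + e * (e + Q' + 2 * P') ≡ (Q * Q' + P' * P') + (Q' * d + e * (e + Q' + 2 * P'))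
        l₂ = solve-∀

  next-Q-bound : ∀ r f Q Q' P' → f < suc r * suc r → Q * Q' + P' * P' ≡ f → P' ≤ r → r < P' + Q → Q' ≤ P' + r
  next-Q-bound r f Q Q' P' f<[r+1]² norm P'≤r r<P'+Q = ≮⇒≥ too-big
    where
    too-big : P' + r < Q' → ⊥
    too-big P'+r<Q' with m≤n⇒∃[o]m+o≡n P'≤r | m≤n⇒∃[o]m+o≡n P'+r<Q'
    ... | d , refl | e , refl with m≤n⇒∃[o]m+o≡n r<P'+Q
    ... | g , eg = <-irrefl refl (<-≤-trans f<[r+1]² (≤-trans (m≤m+n _ _) (≤-reflexive (sym expand))))
      where
      open ≡-Reasoning
      Q≡ : Q ≡ suc (d + g)
      Q≡ = +-cancelˡ-≡ P' Q (suc (d + g)) (trans (sym eg) (l₀ P' d g))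
        where
        l₀ : ∀ P' d g → suc (P' + d) + g ≡ P' + suc (d + g)
        l₀ = solve-∀
      expand : f ≡ suc (P' + d) * suc (P' + d) + (g * (suc (P' + (P' + d)) + e) + suc d * e)
      expand = begin
          f                                                  ≡⟨ sym norm ⟩
          Q * suc (P' + (P' + d) + e) + P' * P'              ≡⟨ cong (λ z → z * suc (P' + (P' + d) + e) + P' * P') Q≡ ⟩
          suc (d + g) * suc (P' + (P' + d) + e) + P' * P'    ≡⟨ l₁ P' d g e ⟩
          suc (P' + d) * suc (P' + d) + (g * (suc (P' + (P' + d)) + e) + suc d * e) ∎
        where
        l₁ : ∀ P' d g e → suc (d + g) * suc (P' + (P' + d) + e) + P' * P' ≡ suc (P' + d) * suc (P' + d) + (g * (suc (P' + (P' + d)) + e) + suc d * e)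
        l₁ = solve-∀

module Theory (f : ℕ) (r²<f : isqrt f ℕ.* isqrt f ℕ.< f) (1≤r : 1 ℕ.≤ isqrt f) where

  r : ℕ
  r = isqrt f

  module Reduction where
    open import Data.Nat
    open import Data.Nat.Properties
    open import Data.Product using (_×_; _,_; proj₁; proj₂)
    open import Relation.Binary.PropositionalEquality
    open import Data.Empty using (⊥-elim)
    open import Relation.Nullary using (yes; no)
    open import Data.Nat.Tactic.RingSolver using (solve-∀)
    open IntegerSqrt using (isqrt-lt)
    open Arithmetic

    -- One step of the algorithm on a pair (P, Q), definitionally the step of PQ.
    a-of : ℕ × ℕ → ℕ
    a-of s = (proj₁ s + r) div proj₂ s

    next : ℕ × ℕ → ℕ × ℕ
    next s = (a-of s * proj₂ s ∸ proj₁ s) , ((f ∸ (a-of s * proj₂ s ∸ proj₁ s) * (a-of s * proj₂ s ∸ proj₁ s)) div proj₂ s)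

    module Step (P Q R : ℕ) (1≤Q : 1 ≤ Q) (P≤r : P ≤ r) (Q≤P+r : Q ≤ P + r)
                (norm : Q * R + P * P ≡ f) where
      a : ℕ
      a = a-of (P , Q)

      P' : ℕ
      P' = a * Q ∸ P

      Q' : ℕ
      Q' = proj₂ (next (P , Q))

      P+r<aQ+Q : P + r < a * Q + Q
      P+r<aQ+Q = div-floor-> (P + r) Q 1≤Q

      1≤a : 1 ≤ a
      1≤a with a in eqa
      ... | zero = ⊥-elim (<-irrefl refl (<-≤-trans (subst (λ z → P + r < z * Q + Q) eqa P+r<aQ+Q) Q≤P+r))
      ... | suc _ = s≤s z≤n

      Q≤aQ : Q ≤ a * Q
      Q≤aQ = subst (_≤ a * Q) (*-identityˡ Q) (*-monoˡ-≤ Q 1≤a)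

      P≤aQ : P ≤ a * Q
      P≤aQ with Q ≤? r
      ... | yes Q≤r = <⇒≤ (+-cancelʳ-< r P (a * Q) (<-≤-trans P+r<aQ+Q (+-monoʳ-≤ (a * Q) Q≤r)))
      ... | no Q≰r = ≤-trans (≤-trans P≤r (<⇒≤ (≰⇒> Q≰r))) Q≤aQ

      P'+P≡aQ : P' + P ≡ a * Q
      P'+P≡aQ = m∸n+n≡m P≤aQ

      P'≤r : P' ≤ r
      P'≤r = +-cancelʳ-≤ P P' r (subst (_≤ r + P) (sym P'+P≡aQ)
               (subst (a * Q ≤_) (+-comm P r) (div-floor-≤ (P + r) Q 1≤Q)))

      r<P'+Q : r < P' + Q
      r<P'+Q = +-cancelˡ-< P r (P' + Q) (subst (P + r <_) regroup P+r<aQ+Q)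
        where
        regroup : a * Q + Q ≡ P + (P' + Q)
        regroup = trans (cong (_+ Q) (trans (sym P'+P≡aQ) (+-comm P' P))) (+-assoc P P' Q)

      -- The new remainder R' = R + a P - a P' is a natural number: Q · aP' ≤ Q · (R + aP)
      -- because Q · aP' = P'² + P P', Q · (R + aP) = f + P P' and P'² ≤ r² < f.
      Q·aP' : Q * (a * P') ≡ P' * P' + P * P'
      Q·aP' = trans (l₁ Q a P') (trans (cong (_* P') (sym P'+P≡aQ)) (l₂ P' P))
        where
        l₁ : ∀ Q a P' → Q * (a * P') ≡ (a * Q) * P'
        l₁ = solve-∀
        l₂ : ∀ P' P → (P' + P) * P' ≡ P' * P' + P * P'
        l₂ = solve-∀

      Q·[R+aP] : Q * (R + a * P) ≡ (Q * R + P * P) + P' * P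
      Q·[R+aP] = trans (l₁ Q R a P) (trans (cong (λ z → Q * R + z * P) (sym P'+P≡aQ)) (l₂ Q R P' P))
        where
        l₁ : ∀ Q R a P → Q * (R + a * P) ≡ Q * R + (a * Q) * P
        l₁ = solve-∀
        l₂ : ∀ Q R P' P → Q * R + (P' + P) * P ≡ (Q * R + P * P) + P' * P
        l₂ = solve-∀

      aP'≤R+aP : a * P' ≤ R + a * P
      aP'≤R+aP = *-cancelˡ-≤ Q {{>-nonZero 1≤Q}} (subst₂ _≤_ (sym Q·aP') (sym Q·[R+aP])
                   (+-mono-≤ (subst (P' * P' ≤_) (sym norm) P'²≤f) (≤-reflexive (*-comm P P'))))
        where
        P'²≤f : P' * P' ≤ f
        P'²≤f = ≤-trans (*-mono-≤ P'≤r P'≤r) (<⇒≤ r²<f)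

      R' : ℕ
      R' = proj₁ (m≤n⇒∃[o]m+o≡n aP'≤R+aP)

      QR'+P'²≡f : Q * R' + P' * P' ≡ f
      QR'+P'²≡f = +-cancelʳ-≡ (P * P') (Q * R' + P' * P') f (begin
          Q * R' + P' * P' + P * P'   ≡⟨ l (Q * R') (P' * P') (P * P') ⟩
          (P' * P' + P * P') + Q * R' ≡⟨ cong (_+ Q * R') (sym Q·aP') ⟩
          Q * (a * P') + Q * R'       ≡⟨ sym (*-distribˡ-+ Q (a * P') R') ⟩
          Q * (a * P' + R')           ≡⟨ cong (Q *_) (proj₂ (m≤n⇒∃[o]m+o≡n aP'≤R+aP)) ⟩
          Q * (R + a * P)             ≡⟨ Q·[R+aP] ⟩
          (Q * R + P * P) + P' * P    ≡⟨ cong₂ _+_ norm (*-comm P' P) ⟩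
          f + P * P'                  ∎)
        where
        open ≡-Reasoning
        l : ∀ x y z → x + y + z ≡ (y + z) + x
        l = solve-∀

      QQ'+P'²≡f : Q * Q' + P' * P' ≡ f
      QQ'+P'²≡f = subst (λ z → Q * z + P' * P' ≡ f) (sym Q'≡R') QR'+P'²≡f
        where
        Q'≡R' : Q' ≡ R'
        Q'≡R' = trans (cong (_div Q) (trans (cong (_∸ P' * P') (sym QR'+P'²≡f)) (m+n∸n≡m (Q * R') (P' * P'))))
                      (div-exact R' Q 1≤Q)

      Q≤P'+r : Q ≤ P' + r
      Q≤P'+r = ≤-trans Q≤aQ (subst (_≤ P' + r) P'+P≡aQ (+-monoʳ-≤ P' P≤r))

      r<P'+Q' : r < P' + Q'
      r<P'+Q' = root<sum r f Q Q' P' r²<f QQ'+P'²≡f Q≤P'+r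

      Q'≤P'+r : Q' ≤ P' + r
      Q'≤P'+r = next-Q-bound r f Q Q' P' (isqrt-lt f) QQ'+P'²≡f P'≤r r<P'+Q

      1≤Q' : 1 ≤ Q'
      1≤Q' with Q' in eq0
      ... | zero = ⊥-elim (<-irrefl refl (<-≤-trans (subst (λ z → r < P' + z) eq0 r<P'+Q')
                     (subst (_≤ r) (sym (+-identityʳ P')) P'≤r)))
      ... | suc _ = s≤s z≤n

    Pk : ℕ → ℕ
    Pk k = proj₁ (PQ f k)

    Qk : ℕ → ℕ
    Qk k = proj₂ (PQ f k)

    ak : ℕ → ℕ
    ak k = cfA f k

    record Reduced (k : ℕ) : Set where
      field
        1≤Q   : 1 ≤ Qk k
        P≤r   : Pk k ≤ r
        Q≤P+r : Qk k ≤ Pk k + r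
        R     : ℕ
        norm  : Qk k * R + Pk k * Pk k ≡ f

    reduced : ∀ k → Reduced k
    reduced zero = record { 1≤Q = s≤s z≤n ; P≤r = z≤n ; Q≤P+r = 1≤r ; R = f
                          ; norm = trans (+-identityʳ (f + 0)) (+-identityʳ f) }
    reduced (suc k) = record
      { 1≤Q = 1≤Q' ; P≤r = P'≤r ; Q≤P+r = Q'≤P'+r ; R = Qk k
      ; norm = trans (cong (_+ P' * P') (*-comm Q' (Qk k))) QQ'+P'²≡f }
      where
      open Reduced (reduced k)
      open Step (Pk k) (Qk k) R 1≤Q P≤r Q≤P+r norm

    module StepAt (k : ℕ) = Step (Pk k) (Qk k) (Reduced.R (reduced k)) (Reduced.1≤Q (reduced k))
                                 (Reduced.P≤r (reduced k)) (Reduced.Q≤P+r (reduced k)) (Reduced.norm (reduced k))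

    Q≥1 : ∀ k → 1 ≤ Qk k
    Q≥1 k = Reduced.1≤Q (reduced k)

    P≤r : ∀ k → Pk k ≤ r
    P≤r k = Reduced.P≤r (reduced k)

    a≥1 : ∀ k → 1 ≤ ak k
    a≥1 = StepAt.1≤a

    P-sum : ∀ k → Pk (suc k) + Pk k ≡ ak k * Qk k
    P-sum = StepAt.P'+P≡aQ

    Q-norm : ∀ k → Qk k * Qk (suc k) + Pk (suc k) * Pk (suc k) ≡ f
    Q-norm = StepAt.QQ'+P'²≡f

    r<P+Q : ∀ k → r < Pk (suc k) + Qk (suc k)
    r<P+Q = StepAt.r<P'+Q'

  module Norms where
    open Reduction
    open import Data.Integer hiding (suc; sign)
    open import Data.Integer.Properties
    open import Relation.Binary.PropositionalEquality
    open import Data.Integer.Tactic.RingSolver using (solve-∀)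
    open import Data.Sum using (_⊎_; inj₁; inj₂)
    import Data.Nat.Properties as NP

    Az Bz Pz Qz az : ℕ → ℤ
    Az k = + Aₛ f k
    Bz k = + Bₛ f k
    Pz k = + Pk k
    Qz k = + Qk k
    az k = + ak k

    fz : ℤ
    fz = + f

    sign : ℕ → ℤ
    sign zero = + 1
    sign (suc k) = - sign k

    sign± : ∀ k → sign k ≡ + 1 ⊎ sign k ≡ - + 1
    sign± zero = inj₁ refl
    sign± (suc k) with sign± k
    ... | inj₁ e = inj₂ (cong -_ e)
    ... | inj₂ e = inj₁ (cong -_ e)

    sign-even : ∀ k → sign (k ℕ.+ k) ≡ + 1
    sign-even zero = refl
    sign-even (suc k) = trans (cong (λ z → sign (suc z)) (NP.+-suc k k))
                              (trans (neg-involutive (sign (k ℕ.+ k))) (sign-even k))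

    N : ℤ → ℤ → ℤ
    N x y = x * x - fz * (y * y)

    F : ℤ → ℤ → ℤ → ℤ → ℤ
    F Q P u v = (Q * u - P * v) * (Q * u - P * v) - fz * (v * v)

    A-rec : ∀ k → Az (suc (suc k)) ≡ az k * Az (suc k) + Az k
    A-rec k = trans (pos-+ (ak k ℕ.* Aₛ f (suc k)) (Aₛ f k)) (cong (_+ Az k) (pos-* (ak k) (Aₛ f (suc k))))

    B-rec : ∀ k → Bz (suc (suc k)) ≡ az k * Bz (suc k) + Bz k
    B-rec k = trans (pos-+ (ak k ℕ.* Bₛ f (suc k)) (Bₛ f k)) (cong (_+ Bz k) (pos-* (ak k) (Bₛ f (suc k))))

    P-sumz : ∀ k → az k * Qz k ≡ Pz k + Pz (suc k)
    P-sumz k = trans (sym (pos-* (ak k) (Qk k)))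
                 (trans (cong +_ (sym (P-sum k))) (trans (pos-+ (Pk (suc k)) (Pk k)) (+-comm (Pz (suc k)) (Pz k))))

    Q-normz : ∀ k → fz ≡ Qz k * Qz (suc k) + Pz (suc k) * Pz (suc k)
    Q-normz k = trans (cong +_ (sym (Q-norm k)))
                  (trans (pos-+ (Qk k ℕ.* Qk (suc k)) _) (cong₂ _+_ (pos-* (Qk k) _) (pos-* (Pk (suc k)) _)))

    Q-cancel : ∀ k x y → Qz k * x ≡ Qz k * y → x ≡ y
    Q-cancel k x y eq with Qk k | Q≥1 k
    ... | suc q | _ = *-cancelˡ-≡ (+ suc q) x y eq

    step-identity : ∀ Q Q' P P' a u v ff → a * Q ≡ P + P' → ff ≡ Q * Q' + P' * P' →
      Q' * ((Q * (a * u + v) - P * u) * (Q * (a * u + v) - P * u) - ff * (u * u))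
        ≡ - (Q * ((Q' * u - P' * v) * (Q' * u - P' * v) - ff * (v * v)))
    step-identity Q Q' P P' a u v ff aQ≡P+P' refl = begin
        Q' * (sq (Q * (a * u + v) - P * u) - (Q * Q' + P' * P') * (u * u))
      ≡⟨ l₁ Q Q' P P' a u v ⟩
        Q' * (sq ((a * Q) * u + Q * v - P * u) - (Q * Q' + P' * P') * (u * u))
      ≡⟨ cong (λ z → Q' * (sq (z * u + Q * v - P * u) - (Q * Q' + P' * P') * (u * u))) aQ≡P+P' ⟩
        Q' * (sq ((P + P') * u + Q * v - P * u) - (Q * Q' + P' * P') * (u * u))
      ≡⟨ l₂ Q Q' P P' u v ⟩
        - (Q * (sq (Q' * u - P' * v) - (Q * Q' + P' * P') * (v * v))) ∎
      where
      open ≡-Reasoning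
      sq : ℤ → ℤ
      sq x = x * x
      l₁ : ∀ Q Q' P P' a u v → Q' * ((Q * (a * u + v) - P * u) * (Q * (a * u + v) - P * u) - (Q * Q' + P' * P') * (u * u)) ≡ Q' * (((a * Q) * u + Q * v - P * u) * ((a * Q) * u + Q * v - P * u) - (Q * Q' + P' * P') * (u * u))
      l₁ = solve-∀
      l₂ : ∀ Q Q' P P' u v → Q' * (((P + P') * u + Q * v - P * u) * ((P + P') * u + Q * v - P * u) - (Q * Q' + P' * P') * (u * u)) ≡ - (Q * ((Q' * u - P' * v) * (Q' * u - P' * v) - (Q * Q' + P' * P') * (v * v)))
      l₂ = solve-∀

    norm-identity : ∀ k u v → Qz k * N (u * Az (suc k) + v * Az k) (u * Bz (suc k) + v * Bz k)
                              ≡ sign k * F (Qz k) (Pz k) u v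
    norm-identity zero u v = l u v fz
      where
      l : ∀ u v ff → + 1 * ((u * + 1 + v * + 0) * (u * + 1 + v * + 0) - ff * ((u * + 0 + v * + 1) * (u * + 0 + v * + 1)))
                     ≡ + 1 * ((+ 1 * u - + 0 * v) * (+ 1 * u - + 0 * v) - ff * (v * v))
      l = solve-∀
    norm-identity (suc k) u v = Q-cancel k _ _ (begin
        Q * (Q' * N (u * Az (suc (suc k)) + v * Az (suc k)) (u * Bz (suc (suc k)) + v * Bz (suc k)))
      ≡⟨ cong₂ (λ x y → Q * (Q' * N x y)) (trans (cong (λ z → u * z + v * A₁) (A-rec k)) (shift u v a A₁ A₀))
                                          (trans (cong (λ z → u * z + v * B₁) (B-rec k)) (shift u v a B₁ B₀)) ⟩
        Q * (Q' * N ((a * u + v) * A₁ + u * A₀) ((a * u + v) * B₁ + u * B₀))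
      ≡⟨ l₁ Q Q' (N ((a * u + v) * A₁ + u * A₀) ((a * u + v) * B₁ + u * B₀)) ⟩
        Q' * (Q * N ((a * u + v) * A₁ + u * A₀) ((a * u + v) * B₁ + u * B₀))
      ≡⟨ cong (Q' *_) (norm-identity k (a * u + v) u) ⟩
        Q' * (s * F Q P (a * u + v) u)
      ≡⟨ l₂ Q' s (F Q P (a * u + v) u) ⟩
        s * (Q' * F Q P (a * u + v) u)
      ≡⟨ cong (s *_) (step-identity Q Q' P P' a u v fz (P-sumz k) (Q-normz k)) ⟩
        s * (- (Q * F Q' P' u v))
      ≡⟨ l₃ Q s (F Q' P' u v) ⟩
        Q * (- s * F Q' P' u v) ∎)
      where
      open ≡-Reasoning
      Q = Qz k
      Q' = Qz (suc k)
      P = Pz k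
      P' = Pz (suc k)
      a = az k
      s = sign k
      A₁ = Az (suc k)
      A₀ = Az k
      B₁ = Bz (suc k)
      B₀ = Bz k
      shift : ∀ u v a X₁ X₀ → u * (a * X₁ + X₀) + v * X₁ ≡ (a * u + v) * X₁ + u * X₀
      shift = solve-∀
      l₁ : ∀ Q Q' n → Q * (Q' * n) ≡ Q' * (Q * n)
      l₁ = solve-∀
      l₂ : ∀ Q' s x → Q' * (s * x) ≡ s * (Q' * x)
      l₂ = solve-∀
      l₃ : ∀ Q s x → s * (- (Q * x)) ≡ Q * (- s * x)
      l₃ = solve-∀

    determinant : ∀ k → Az (suc k) * Bz k - Az k * Bz (suc k) ≡ sign k
    determinant zero = refl
    determinant (suc k) = begin
        Az (suc (suc k)) * Bz (suc k) - Az (suc k) * Bz (suc (suc k))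
      ≡⟨ cong₂ (λ x y → x * Bz (suc k) - Az (suc k) * y) (A-rec k) (B-rec k) ⟩
        (az k * Az (suc k) + Az k) * Bz (suc k) - Az (suc k) * (az k * Bz (suc k) + Bz k)
      ≡⟨ l (az k) (Az (suc k)) (Az k) (Bz (suc k)) (Bz k) ⟩
        - (Az (suc k) * Bz k - Az k * Bz (suc k))
      ≡⟨ cong -_ (determinant k) ⟩
        sign (suc k) ∎
      where
      open ≡-Reasoning
      l : ∀ a A₁ A₀ B₁ B₀ → (a * A₁ + A₀) * B₁ - A₁ * (a * B₁ + B₀) ≡ - (A₁ * B₀ - A₀ * B₁)
      l = solve-∀

    determinant-odd : ∀ n → let k = suc (n ℕ.+ n) in
      Aₛ f k ℕ.* Bₛ f (suc k) ≡ Aₛ f (suc k) ℕ.* Bₛ f k ℕ.+ 1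
    determinant-odd n = +-injective (begin
        + (A₀ ℕ.* B₁)                 ≡⟨ pos-* A₀ B₁ ⟩
        + A₀ * + B₁                   ≡⟨ l₁ (+ A₀ * + B₁) (+ A₁ * + B₀) ⟩
        + A₁ * + B₀ - (+ A₁ * + B₀ - + A₀ * + B₁)
                                      ≡⟨ cong (λ z → + A₁ * + B₀ - z) (trans (determinant k) (cong -_ (sign-even n))) ⟩
        + A₁ * + B₀ - - + 1           ≡⟨ l₂ (+ A₁ * + B₀) ⟩
        + A₁ * + B₀ + + 1             ≡⟨ cong (_+ + 1) (sym (pos-* A₁ B₀)) ⟩
        + (A₁ ℕ.* B₀) + + 1           ≡⟨ sym (pos-+ (A₁ ℕ.* B₀) 1) ⟩
        + (A₁ ℕ.* B₀ ℕ.+ 1)           ∎)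
      where
      open ≡-Reasoning
      k = suc (n ℕ.+ n)
      A₀ = Aₛ f k
      A₁ = Aₛ f (suc k)
      B₀ = Bₛ f k
      B₁ = Bₛ f (suc k)
      l₁ : ∀ x y → x ≡ y - (y - x)
      l₁ = solve-∀
      l₂ : ∀ x → x - - + 1 ≡ x + + 1
      l₂ = solve-∀

    N-cast : ∀ x y → x ℕ.* x ≡ f ℕ.* (y ℕ.* y) ℕ.+ 1 → N (+ x) (+ y) ≡ + 1
    N-cast x y pell = begin
        + x * + x - fz * (+ y * + y)                    ≡⟨ cong₂ (λ a b → a - fz * b) (sym (pos-* x x)) (sym (pos-* y y)) ⟩
        + (x ℕ.* x) - fz * + (y ℕ.* y)                  ≡⟨ cong (λ z → + (x ℕ.* x) - z) (sym (pos-* f (y ℕ.* y))) ⟩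
        + (x ℕ.* x) - + (f ℕ.* (y ℕ.* y))               ≡⟨ cong (λ z → z - + (f ℕ.* (y ℕ.* y))) (trans (cong +_ pell) (pos-+ (f ℕ.* (y ℕ.* y)) 1)) ⟩
        + (f ℕ.* (y ℕ.* y)) + + 1 - + (f ℕ.* (y ℕ.* y)) ≡⟨ l (+ (f ℕ.* (y ℕ.* y))) ⟩
        + 1                                             ∎
      where
      open ≡-Reasoning
      l : ∀ a → a + + 1 - a ≡ + 1
      l = solve-∀

    N-uncast : ∀ x y → N (+ x) (+ y) ≡ + 1 → x ℕ.* x ≡ f ℕ.* (y ℕ.* y) ℕ.+ 1
    N-uncast x y N≡1 = +-injective (begin
        + (x ℕ.* x)                        ≡⟨ pos-* x x ⟩
        + x * + x                          ≡⟨ l (+ x * + x) (fz * (+ y * + y)) ⟩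
        N (+ x) (+ y) + fz * (+ y * + y)   ≡⟨ cong (_+ fz * (+ y * + y)) N≡1 ⟩
        + 1 + fz * (+ y * + y)             ≡⟨ +-comm (+ 1) (fz * (+ y * + y)) ⟩
        fz * (+ y * + y) + + 1             ≡⟨ cong (λ z → fz * z + + 1) (sym (pos-* y y)) ⟩
        fz * + (y ℕ.* y) + + 1             ≡⟨ cong (_+ + 1) (sym (pos-* f (y ℕ.* y))) ⟩
        + (f ℕ.* (y ℕ.* y)) + + 1          ≡⟨ sym (pos-+ (f ℕ.* (y ℕ.* y)) 1) ⟩
        + (f ℕ.* (y ℕ.* y) ℕ.+ 1)          ∎)
      where
      open ≡-Reasoning
      l : ∀ x y → x ≡ (x - y) + y
      l = solve-∀

    pell-at : ∀ k → Qk k ≡ 1 → sign k ≡ + 1 →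
              Aₛ f (suc k) ℕ.* Aₛ f (suc k) ≡ f ℕ.* (Bₛ f (suc k) ℕ.* Bₛ f (suc k)) ℕ.+ 1
    pell-at k Q≡1 s≡1 = N-uncast A B (begin
        N (+ A) (+ B)                                              ≡⟨ l₁ (+ A) (+ B) (Az k) (Bz k) ⟩
        + 1 * N (+ 1 * + A + + 0 * Az k) (+ 1 * + B + + 0 * Bz k)  ≡⟨ cong (λ q → + q * N (+ 1 * + A + + 0 * Az k) (+ 1 * + B + + 0 * Bz k)) (sym Q≡1) ⟩
        Qz k * N (+ 1 * + A + + 0 * Az k) (+ 1 * + B + + 0 * Bz k) ≡⟨ norm-identity k (+ 1) (+ 0) ⟩
        sign k * F (Qz k) (Pz k) (+ 1) (+ 0)                       ≡⟨ cong₂ (λ s q → s * F (+ q) (Pz k) (+ 1) (+ 0)) s≡1 Q≡1 ⟩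
        + 1 * F (+ 1) (Pz k) (+ 1) (+ 0)                           ≡⟨ l₂ (Pz k) fz ⟩
        + 1                                                        ∎)
      where
      open ≡-Reasoning
      A = Aₛ f (suc k)
      B = Bₛ f (suc k)
      l₁ : ∀ A B A₀ B₀ → A * A - fz * (B * B) ≡ + 1 * ((+ 1 * A + + 0 * A₀) * (+ 1 * A + + 0 * A₀) - fz * ((+ 1 * B + + 0 * B₀) * (+ 1 * B + + 0 * B₀)))
      l₁ A B A₀ B₀ = l A B A₀ B₀ fz
        where
        l : ∀ A B A₀ B₀ ff → A * A - ff * (B * B) ≡ + 1 * ((+ 1 * A + + 0 * A₀) * (+ 1 * A + + 0 * A₀) - ff * ((+ 1 * B + + 0 * B₀) * (+ 1 * B + + 0 * B₀)))
        l = solve-∀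
      l₂ : ∀ P ff → + 1 * ((+ 1 * + 1 - P * + 0) * (+ 1 * + 1 - P * + 0) - ff * (+ 0 * + 0)) ≡ + 1
      l₂ = solve-∀

  module Growth where
    open Reduction
    open import Data.Nat
    open import Data.Nat.Properties
    open import Data.Product using (_,_)
    open import Relation.Binary.PropositionalEquality
    open import Data.Nat.Tactic.RingSolver using (solve-∀)

    -- Any sequence X with X_{n+2} = a_n X_{n+1} + X_n is non-decreasing from index 1 on,
    -- because every a_n ≥ 1.
    continuant-mono : (X : ℕ → ℕ) → (∀ n → X (suc (suc n)) ≡ ak n * X (suc n) + X n) →
                      ∀ {i j} → i ≤ j → X (suc i) ≤ X (suc j)
    continuant-mono X X-rec {i} i≤j with m≤n⇒∃[o]m+o≡n i≤j
    ... | d , refl = go d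
      where
      one-step : ∀ n → X (suc n) ≤ X (suc (suc n))
      one-step n = ≤-trans (≤-trans (≤-reflexive (sym (*-identityˡ (X (suc n))))) (*-monoˡ-≤ (X (suc n)) (a≥1 n)))
                           (≤-trans (m≤m+n (ak n * X (suc n)) (X n)) (≤-reflexive (sym (X-rec n))))
      go : ∀ d → X (suc i) ≤ X (suc (i + d))
      go zero = ≤-reflexive (cong (λ z → X (suc z)) (sym (+-identityʳ i)))
      go (suc d) = ≤-trans (go d) (≤-trans (one-step (i + d)) (≤-reflexive (cong (λ z → X (suc z)) (sym (+-suc i d)))))

    A-mono : ∀ {i j} → i ≤ j → Aₛ f (suc i) ≤ Aₛ f (suc j)
    A-mono = continuant-mono (Aₛ f) (λ _ → refl)

    B-mono : ∀ {i j} → i ≤ j → Bₛ f (suc i) ≤ Bₛ f (suc j)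
    B-mono = continuant-mono (Bₛ f) (λ _ → refl)

    A-pos : ∀ L → 1 ≤ L → 1 ≤ Aₛ f (suc L)
    A-pos (suc L) _ = ≤-trans (≤-trans (a≥1 0) (≤-reflexive (l (cfA f 0)))) (A-mono {1} {suc L} (s≤s z≤n))
      where
      l : ∀ a → a ≡ a * 1 + 0
      l = solve-∀

    B-pos : ∀ L → 1 ≤ L → 1 ≤ Bₛ f (suc L)
    B-pos (suc L) _ = ≤-trans (m≤n+m 1 (cfA f 0 * 0)) (B-mono {1} {suc L} (s≤s z≤n))

  module Legendre where
    open Reduction
    open Norms
    open import Data.Integer hiding (suc; sign)
    open import Data.Integer.Properties
    open import Relation.Binary.PropositionalEquality
    open import Data.Integer.Tactic.RingSolver using (solve-∀)
    open import Data.Product using (_×_; _,_; proj₁; proj₂)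
    open import Data.Sum using (inj₁; inj₂)
    open import Data.Empty using (⊥; ⊥-elim)
    import Data.Nat.Properties as NP
    import Data.Nat.Tactic.RingSolver as NS

    square-split : ∀ Q P P' e d u v t rz → rz ≡ P' + e → rz ≡ P + d → Q * (u + t) ≡ (P + P') * v →
      (rz * v) * (rz * v) ≡ (e * v + Q * t) * (d * v + Q * u) + (Q * u - P * v) * (Q * u - P * v)
    square-split Q P P' e d u v t rz r≡P'+e r≡P+d Q[u+t] = begin
        (rz * v) * (rz * v)                            ≡⟨ l₀ rz v w ⟩
        (rz * v - w) * (rz * v + w) + w * w             ≡⟨ cong₂ (λ x y → x * y + w * w) minus plus ⟩
        (e * v + Q * t) * (d * v + Q * u) + w * w       ∎
      where
      open ≡-Reasoning
      w = Q * u - P * v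
      l₀ : ∀ R v w → (R * v) * (R * v) ≡ (R * v - w) * (R * v + w) + w * w
      l₀ = solve-∀
      minus : rz * v - w ≡ e * v + Q * t
      minus = begin
          rz * v - w                                     ≡⟨ cong (λ z → z * v - w) r≡P'+e ⟩
          (P' + e) * v - (Q * u - P * v)                 ≡⟨ l₁ P' e v Q u P t ⟩
          e * v + Q * t + ((P + P') * v - Q * (u + t))   ≡⟨ cong (λ z → e * v + Q * t + ((P + P') * v - z)) Q[u+t] ⟩
          e * v + Q * t + ((P + P') * v - (P + P') * v)  ≡⟨ l₂ (e * v + Q * t) ((P + P') * v) ⟩
          e * v + Q * t                                  ∎
        where
        l₁ : ∀ P' e v Q u P t → (P' + e) * v - (Q * u - P * v) ≡ e * v + Q * t + ((P + P') * v - Q * (u + t))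
        l₁ = solve-∀
        l₂ : ∀ x y → x + (y - y) ≡ x
        l₂ = solve-∀
      plus : rz * v + w ≡ d * v + Q * u
      plus = trans (cong (λ z → z * v + w) r≡P+d) (l P d v Q u)
        where
        l : ∀ P d v Q u → (P + d) * v + (Q * u - P * v) ≡ d * v + Q * u
        l = solve-∀

    scaled-root-bound : ∀ v → 1 ℕ.≤ v → (r ℕ.* v) ℕ.* (r ℕ.* v) ℕ.< f ℕ.* (v ℕ.* v)
    scaled-root-bound (suc v₀) _ = subst (ℕ._< f ℕ.* (suc v₀ ℕ.* suc v₀)) (l r (suc v₀)) (NP.*-monoˡ-< (suc v₀ ℕ.* suc v₀) r²<f)
      where
      l : ∀ r v → (r ℕ.* r) ℕ.* (v ℕ.* v) ≡ (r ℕ.* v) ℕ.* (r ℕ.* v)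
      l = NS.solve-∀

    -- If the norm identity gives Q_k = ± F_{Q_k,P_k}(u, v) with u, v ≥ 1, then u ≥ a_k v.
    -- Otherwise t = a_k v - u ≥ 1 and square-split writes (r v)² = X Y + w² with
    -- X, Y ≥ Q_k, which is incompatible with r² < f whatever the sign (-1)^k.
    module QuotientTooLarge (k u v : ℕ) (1≤u : 1 ℕ.≤ u) (1≤v : 1 ℕ.≤ v)
        (form : Qz k ≡ sign k * F (Qz k) (Pz k) (+ u) (+ v)) (u<av : u ℕ.< ak k ℕ.* v) where
      t e d : ℕ
      t = suc (proj₁ (NP.m≤n⇒∃[o]m+o≡n u<av))
      e = proj₁ (NP.m≤n⇒∃[o]m+o≡n (P≤r (suc k)))
      d = proj₁ (NP.m≤n⇒∃[o]m+o≡n (P≤r k))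

      X Y RR fvv : ℕ
      X = e ℕ.* v ℕ.+ Qk k ℕ.* t
      Y = d ℕ.* v ℕ.+ Qk k ℕ.* u
      RR = (r ℕ.* v) ℕ.* (r ℕ.* v)
      fvv = f ℕ.* (v ℕ.* v)

      w : ℤ
      w = Qz k * + u - Pz k * + v

      Q[u+t] : Qz k * (+ u + + t) ≡ (Pz k + Pz (suc k)) * + v
      Q[u+t] = begin
          Qz k * (+ u + + t)                ≡⟨ cong (Qz k *_) (sym (pos-+ u t)) ⟩
          Qz k * + (u ℕ.+ t)                ≡⟨ sym (pos-* (Qk k) (u ℕ.+ t)) ⟩
          + (Qk k ℕ.* (u ℕ.+ t))            ≡⟨ cong +_ in-ℕ ⟩
          + ((Pk k ℕ.+ Pk (suc k)) ℕ.* v)   ≡⟨ pos-* (Pk k ℕ.+ Pk (suc k)) v ⟩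
          + (Pk k ℕ.+ Pk (suc k)) * + v     ≡⟨ cong (_* + v) (pos-+ (Pk k) (Pk (suc k))) ⟩
          (Pz k + Pz (suc k)) * + v         ∎
        where
        open ≡-Reasoning
        u+t≡av : u ℕ.+ t ≡ ak k ℕ.* v
        u+t≡av = trans (NP.+-suc u _) (proj₂ (NP.m≤n⇒∃[o]m+o≡n u<av))
        l : ∀ Q a v → Q ℕ.* (a ℕ.* v) ≡ (a ℕ.* Q) ℕ.* v
        l = NS.solve-∀
        in-ℕ : Qk k ℕ.* (u ℕ.+ t) ≡ (Pk k ℕ.+ Pk (suc k)) ℕ.* v
        in-ℕ = trans (cong (Qk k ℕ.*_) u+t≡av) (trans (l (Qk k) (ak k) v)
                 (cong (ℕ._* v) (trans (sym (P-sum k)) (NP.+-comm (Pk (suc k)) (Pk k)))))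

      split : + RR ≡ + (X ℕ.* Y) + w * w
      split = begin
          + RR                                          ≡⟨ trans (pos-* (r ℕ.* v) (r ℕ.* v)) (cong₂ _*_ (pos-* r v) (pos-* r v)) ⟩
          (+ r * + v) * (+ r * + v)                     ≡⟨ square-split (Qz k) (Pz k) (Pz (suc k)) (+ e) (+ d) (+ u) (+ v) (+ t) (+ r)
                                                             (cast-sum (P≤r (suc k))) (cast-sum (P≤r k)) Q[u+t] ⟩
          (+ e * + v + Qz k * + t) * (+ d * + v + Qz k * + u) + w * w
                                                        ≡⟨ cong (_+ w * w) (sym (trans (pos-* X Y) (cong₂ _*_ (cast-lin e v (Qk k) t) (cast-lin d v (Qk k) u)))) ⟩
          + (X ℕ.* Y) + w * w                           ∎
        where
        open ≡-Reasoning
        cast-sum : ∀ {p} (p≤r : p ℕ.≤ r) → + r ≡ + p + + proj₁ (NP.m≤n⇒∃[o]m+o≡n p≤r)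
        cast-sum {p} p≤r = trans (cong +_ (sym (proj₂ (NP.m≤n⇒∃[o]m+o≡n p≤r)))) (pos-+ p _)
        cast-lin : ∀ a b c x → + (a ℕ.* b ℕ.+ c ℕ.* x) ≡ + a * + b + + c * + x
        cast-lin a b c x = trans (pos-+ (a ℕ.* b) (c ℕ.* x)) (cong₂ _+_ (pos-* a b) (pos-* c x))

      fvv-cast : fz * (+ v * + v) ≡ + fvv
      fvv-cast = sym (trans (pos-* f (v ℕ.* v)) (cong (fz *_) (pos-* v v)))

      rv²<fv² : RR ℕ.< fvv
      rv²<fv² = scaled-root-bound v 1≤v

      -- For even k: w² = Q_k + f v², hence (r v)² = X Y + Q_k + f v² ≥ f v².
      even-case : sign k ≡ + 1 → ⊥
      even-case s≡1 = NP.<-irrefl refl (NP.<-≤-trans rv²<fv² (NP.≤-trans (NP.m≤n+m fvv (X ℕ.* Y ℕ.+ Qk k)) (NP.≤-reflexive (sym in-ℕ))))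
        where
        open ≡-Reasoning
        w² : w * w ≡ Qz k + + fvv
        w² = begin
          w * w                                        ≡⟨ l (w * w) (fz * (+ v * + v)) ⟩
          + 1 * F (Qz k) (Pz k) (+ u) (+ v) + fz * (+ v * + v) ≡⟨ cong (λ z → z * F (Qz k) (Pz k) (+ u) (+ v) + fz * (+ v * + v)) (sym s≡1) ⟩
          sign k * F (Qz k) (Pz k) (+ u) (+ v) + fz * (+ v * + v) ≡⟨ cong₂ _+_ (sym form) fvv-cast ⟩
          Qz k + + fvv                                 ∎
          where
          l : ∀ W V → W ≡ + 1 * (W - V) + V
          l = solve-∀
        in-ℕ : RR ≡ X ℕ.* Y ℕ.+ Qk k ℕ.+ fvv
        in-ℕ = +-injective (begin
          + RR                                ≡⟨ split ⟩
          + (X ℕ.* Y) + w * w                 ≡⟨ cong (λ z → + (X ℕ.* Y) + z) w² ⟩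
          + (X ℕ.* Y) + (Qz k + + fvv)        ≡⟨ sym (+-assoc (+ (X ℕ.* Y)) (Qz k) (+ fvv)) ⟩
          + (X ℕ.* Y) + Qz k + + fvv          ≡⟨ cong (_+ + fvv) (sym (pos-+ (X ℕ.* Y) (Qk k))) ⟩
          + (X ℕ.* Y ℕ.+ Qk k) + + fvv        ≡⟨ sym (pos-+ (X ℕ.* Y ℕ.+ Qk k) fvv) ⟩
          + (X ℕ.* Y ℕ.+ Qk k ℕ.+ fvv)        ∎)

      -- For odd k: Q_k + w² = f v², hence Q_k + (r v)² = X Y + f v², so X Y < Q_k ≤ X Y.
      odd-case : sign k ≡ - + 1 → ⊥
      odd-case s≡-1 = NP.<-irrefl refl (NP.<-≤-trans XY<Q Q≤XY)
        where
        open ≡-Reasoning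
        Q+w² : Qz k + w * w ≡ + fvv
        Q+w² = begin
          Qz k + w * w                                   ≡⟨ cong (_+ w * w) form ⟩
          sign k * F (Qz k) (Pz k) (+ u) (+ v) + w * w   ≡⟨ cong (λ z → z * F (Qz k) (Pz k) (+ u) (+ v) + w * w) s≡-1 ⟩
          - + 1 * (w * w - fz * (+ v * + v)) + w * w     ≡⟨ l (w * w) (fz * (+ v * + v)) ⟩
          fz * (+ v * + v)                               ≡⟨ fvv-cast ⟩
          + fvv                                          ∎
          where
          l : ∀ W V → - + 1 * (W - V) + W ≡ V
          l = solve-∀
        in-ℕ : Qk k ℕ.+ RR ≡ X ℕ.* Y ℕ.+ fvv
        in-ℕ = +-injective (begin
          + (Qk k ℕ.+ RR)                     ≡⟨ pos-+ (Qk k) RR ⟩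
          Qz k + + RR                         ≡⟨ cong (λ z → Qz k + z) split ⟩
          Qz k + (+ (X ℕ.* Y) + w * w)        ≡⟨ l (Qz k) (+ (X ℕ.* Y)) (w * w) ⟩
          + (X ℕ.* Y) + (Qz k + w * w)        ≡⟨ cong (λ z → + (X ℕ.* Y) + z) Q+w² ⟩
          + (X ℕ.* Y) + + fvv                 ≡⟨ sym (pos-+ (X ℕ.* Y) fvv) ⟩
          + (X ℕ.* Y ℕ.+ fvv)                 ∎)
          where
          l : ∀ a b c → a + (b + c) ≡ b + (a + c)
          l = solve-∀
        XY<Q : X ℕ.* Y ℕ.< Qk k
        XY<Q = NP.+-cancelʳ-< RR (X ℕ.* Y) (Qk k)
                 (subst (X ℕ.* Y ℕ.+ RR ℕ.<_) (sym in-ℕ) (NP.+-monoʳ-< (X ℕ.* Y) rv²<fv²))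
        Q≤Q* : ∀ m → 1 ℕ.≤ m → Qk k ℕ.≤ Qk k ℕ.* m
        Q≤Q* (suc m) _ = NP.m≤m*n (Qk k) (suc m)
        Q≤XY : Qk k ℕ.≤ X ℕ.* Y
        Q≤XY = NP.≤-trans (Q≤Q* (Qk k) (Q≥1 k))
                 (NP.*-mono-≤ (NP.≤-trans (Q≤Q* t (ℕ.s≤s ℕ.z≤n)) (NP.m≤n+m (Qk k ℕ.* t) (e ℕ.* v)))
                              (NP.≤-trans (Q≤Q* u 1≤u) (NP.m≤n+m (Qk k ℕ.* u) (d ℕ.* v))))

      absurd : ⊥
      absurd with sign± k
      ... | inj₁ s≡1 = even-case s≡1
      ... | inj₂ s≡-1 = odd-case s≡-1

    quotient-bound : ∀ k u v → 1 ℕ.≤ u → 1 ℕ.≤ v → Qz k ≡ sign k * F (Qz k) (Pz k) (+ u) (+ v) → ak k ℕ.* v ℕ.≤ u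
    quotient-bound k u v 1≤u 1≤v form = NP.≮⇒≥ (QuotientTooLarge.absurd k u v 1≤u 1≤v form)

    record ConvergentIndex (x y : ℕ) : Set where
      field
        K   : ℕ
        1≤K : 1 ℕ.≤ K
        Q≡1 : Qk K ≡ 1
        x≡A : x ≡ Aₛ f (suc K)
        y≡B : y ≡ Bₛ f (suc K)

    positive≢negative : ∀ Q m → 1 ℕ.≤ Q → + Q ≡ - + 1 * + m → ⊥
    positive≢negative (suc q) m _ e = impossible m (trans e (l (+ m)))
      where
      l : ∀ z → - + 1 * z ≡ - z
      l = solve-∀
      impossible : ∀ m → + suc q ≡ - (+ m) → ⊥
      impossible zero ()
      impossible (suc m) ()

    -- The descent for a fixed solution (x, y), y ≥ 1, written at stage k as
    -- (x, y) = u (A_{k-1}, B_{k-1}) + v (A_{k-2}, B_{k-2}) with u ≥ 1.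
    module Descent (x y : ℕ) (pell : x ℕ.* x ≡ f ℕ.* (y ℕ.* y) ℕ.+ 1) (1≤y : 1 ℕ.≤ y) where
      At : ℕ → ℕ → ℕ → Set
      At k u v = (x ≡ u ℕ.* Aₛ f (suc k) ℕ.+ v ℕ.* Aₛ f k) × (y ≡ u ℕ.* Bₛ f (suc k) ℕ.+ v ℕ.* Bₛ f k)

      form : ∀ k u v → At k u v → Qz k ≡ sign k * F (Qz k) (Pz k) (+ u) (+ v)
      form k u v (x≡ , y≡) = begin
          Qz k                                                                       ≡⟨ sym (*-identityʳ (Qz k)) ⟩
          Qz k * + 1                                                                 ≡⟨ cong (Qz k *_) (sym (N-cast x y pell)) ⟩
          Qz k * N (+ x) (+ y)                                                       ≡⟨ cong₂ (λ a b → Qz k * N a b) (cast x≡) (cast y≡) ⟩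
          Qz k * N (+ u * Az (suc k) + + v * Az k) (+ u * Bz (suc k) + + v * Bz k)   ≡⟨ norm-identity k (+ u) (+ v) ⟩
          sign k * F (Qz k) (Pz k) (+ u) (+ v)                                       ∎
        where
        open ≡-Reasoning
        cast : ∀ {z X₁ X₀} → z ≡ u ℕ.* X₁ ℕ.+ v ℕ.* X₀ → + z ≡ + u * + X₁ + + v * + X₀
        cast {z} {X₁} {X₀} e = trans (cong +_ e) (trans (pos-+ (u ℕ.* X₁) (v ℕ.* X₀)) (cong₂ _+_ (pos-* u X₁) (pos-* v X₀)))

      -- When v = 0 (and k ≥ 1) the form reads Q_k = ±(Q_k u)²; the sign must be +, and
      -- then Q_k u² = 1, so Q_k = u = 1 and (x, y) is the convergent itself.
      terminal-form : ∀ K u → At K u 0 → Qz K ≡ sign K * + ((Qk K ℕ.* u) ℕ.* (Qk K ℕ.* u))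
      terminal-form K u at = trans (form K u 0 at) (cong (sign K *_) (trans (l (Qz K) (Pz K) (+ u) fz)
        (sym (trans (pos-* (Qk K ℕ.* u) (Qk K ℕ.* u)) (cong₂ _*_ (pos-* (Qk K) u) (pos-* (Qk K) u))))))
        where
        l : ∀ Q P u ff → (Q * u - P * + 0) * (Q * u - P * + 0) - ff * (+ 0 * + 0) ≡ (Q * u) * (Q * u)
        l = solve-∀

      terminal : ∀ K u → 1 ℕ.≤ K → At K u 0 → ConvergentIndex x y
      terminal K u 1≤K at with sign± K
      ... | inj₁ s≡1 = record { K = K ; 1≤K = 1≤K ; Q≡1 = Q≡1 ; x≡A = trans (proj₁ at) (drop (Aₛ f (suc K)) (Aₛ f K))
                              ; y≡B = trans (proj₂ at) (drop (Bₛ f (suc K)) (Bₛ f K)) }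
        where
        square = (Qk K ℕ.* u) ℕ.* (Qk K ℕ.* u)
        Q≡[Qu]² : Qk K ≡ (Qk K ℕ.* u) ℕ.* (Qk K ℕ.* u)
        Q≡[Qu]² = +-injective (trans (terminal-form K u at) (trans (cong (_* + square) s≡1) (*-identityˡ (+ square))))
        Qu²≡1 : Qk K ℕ.* (u ℕ.* u) ≡ 1
        Qu²≡1 = NP.*-cancelˡ-≡ (Qk K ℕ.* (u ℕ.* u)) 1 (Qk K) {{ℕ.>-nonZero (Q≥1 K)}}
                  (trans (l (Qk K) u) (trans (sym Q≡[Qu]²) (sym (NP.*-identityʳ (Qk K)))))
          where
          l : ∀ Q u → Q ℕ.* (Q ℕ.* (u ℕ.* u)) ≡ (Q ℕ.* u) ℕ.* (Q ℕ.* u)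
          l = NS.solve-∀
        Q≡1 : Qk K ≡ 1
        Q≡1 = NP.m*n≡1⇒m≡1 (Qk K) (u ℕ.* u) Qu²≡1
        u≡1 : u ≡ 1
        u≡1 = NP.m*n≡1⇒m≡1 u u (NP.m*n≡1⇒n≡1 (Qk K) (u ℕ.* u) Qu²≡1)
        drop : ∀ X₁ X₀ → u ℕ.* X₁ ℕ.+ 0 ℕ.* X₀ ≡ X₁
        drop X₁ X₀ rewrite u≡1 = trans (NP.+-identityʳ (X₁ ℕ.+ 0)) (NP.+-identityʳ X₁)
      ... | inj₂ s≡-1 = ⊥-elim (positive≢negative (Qk K) _ (Q≥1 K) (trans (terminal-form K u at) (cong (_* + ((Qk K ℕ.* u) ℕ.* (Qk K ℕ.* u))) s≡-1)))

      -- One descent step: u ≥ a_k v by quotient-bound, and (k, u, v) becomes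
      -- (k + 1, v, u - a_k v), so u + v strictly decreases (n is the fuel).
      descend : ∀ n k u v → u ℕ.+ v ℕ.≤ n → 1 ℕ.≤ u → At k u v → ConvergentIndex x y
      descend zero k (suc u) v () 1≤u at
      descend (suc n) zero u zero _ _ (_ , y≡) =
        ⊥-elim (NP.<-irrefl refl (NP.<-≤-trans 1≤y (NP.≤-reflexive (trans y≡ (l u)))))
        where
        l : ∀ u → u ℕ.* 0 ℕ.+ 0 ℕ.* 1 ≡ 0
        l = NS.solve-∀
      descend (suc n) (suc k) u zero _ _ at = terminal (suc k) u (ℕ.s≤s ℕ.z≤n) at
      descend (suc n) k u (suc v) u+v≤n 1≤u (x≡ , y≡) =
        descend n (suc k) (suc v) w (NP.≤-pred (NP.<-≤-trans smaller u+v≤n)) (ℕ.s≤s ℕ.z≤n) (regroup refl x≡ , regroup refl y≡)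
        where
        a = ak k
        av≤u : a ℕ.* suc v ℕ.≤ u
        av≤u = quotient-bound k u (suc v) 1≤u (ℕ.s≤s ℕ.z≤n) (form k u (suc v) (x≡ , y≡))
        w = proj₁ (NP.m≤n⇒∃[o]m+o≡n av≤u)
        av+w≡u : a ℕ.* suc v ℕ.+ w ≡ u
        av+w≡u = proj₂ (NP.m≤n⇒∃[o]m+o≡n av≤u)
        smaller : suc v ℕ.+ w ℕ.< u ℕ.+ suc v
        smaller = NP.≤-<-trans (subst (suc v ℕ.+ w ℕ.≤_) av+w≡u (NP.+-monoˡ-≤ w v≤av)) (NP.m<m+n u (ℕ.s≤s ℕ.z≤n))
          where
          v≤av : suc v ℕ.≤ a ℕ.* suc v
          v≤av = subst (ℕ._≤ a ℕ.* suc v) (NP.*-identityˡ (suc v)) (NP.*-monoˡ-≤ (suc v) (a≥1 k))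
        l : ∀ a sv w X₁ X₀ → (a ℕ.* sv ℕ.+ w) ℕ.* X₁ ℕ.+ sv ℕ.* X₀ ≡ sv ℕ.* (a ℕ.* X₁ ℕ.+ X₀) ℕ.+ w ℕ.* X₁
        l = NS.solve-∀
        regroup : ∀ {z X₂ X₁ X₀} → X₂ ≡ a ℕ.* X₁ ℕ.+ X₀ → z ≡ u ℕ.* X₁ ℕ.+ suc v ℕ.* X₀ →
                  z ≡ suc v ℕ.* X₂ ℕ.+ w ℕ.* X₁
        regroup {X₁ = X₁} {X₀} refl e =
          trans e (trans (cong (λ z → z ℕ.* X₁ ℕ.+ suc v ℕ.* X₀) (sym av+w≡u)) (l a (suc v) w X₁ X₀))

    square-succ-pos : ∀ x m → x ℕ.* x ≡ m ℕ.+ 1 → 1 ℕ.≤ x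
    square-succ-pos (suc x) m _ = ℕ.s≤s ℕ.z≤n
    square-succ-pos zero m e = ⊥-elim (0≢1+m (trans e (NP.+-comm m 1)))
      where
      0≢1+m : 0 ≡ suc m → ⊥
      0≢1+m ()

    legendre : ∀ x y → x ℕ.* x ≡ f ℕ.* (y ℕ.* y) ℕ.+ 1 → 1 ℕ.≤ y → ConvergentIndex x y
    legendre x y pell 1≤y = descend (suc (x ℕ.+ y)) zero x y (NP.n≤1+n _) (square-succ-pos x _ pell) (l₁ x y , l₂ x y)
      where
      open Descent x y pell 1≤y
      l₁ : ∀ x y → x ≡ x ℕ.* 1 ℕ.+ y ℕ.* 0
      l₁ = NS.solve-∀
      l₂ : ∀ x y → y ≡ x ℕ.* 0 ℕ.+ y ℕ.* 1
      l₂ = NS.solve-∀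

  -- A period of the partial quotients is a period of the pairs (P_k, Q_k): both x_1
  -- and x_{L+1} are fixed points of the Möbius map of K steps of the expansion,
  -- and that map has a single fixed point of the form (P + √f)/Q.
  module Periodicity where
    open Reduction
    open Norms
    open import Data.Integer hiding (suc; sign)
    open import Data.Integer.Properties
    open import Relation.Binary.PropositionalEquality
    open import Data.Integer.Tactic.RingSolver using (solve-∀)
    open import Data.Product using (_×_; _,_; proj₁; proj₂)
    import Data.Nat.Properties as NP
    open import Data.Nat.DivMod using (n/1≡n)
    open Arithmetic using (square-injective; cancel-*ʳ)

    continuant : (ℕ → ℕ) → ℕ → ℕ → ℕ → ℕ
    continuant g x₀ x₁ zero = x₀
    continuant g x₀ x₁ (suc zero) = x₁
    continuant g x₀ x₁ (suc (suc n)) = g n ℕ.* continuant g x₀ x₁ (suc n) ℕ.+ continuant g x₀ x₁ n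

    continuant-pos : ∀ g → (∀ i → 1 ℕ.≤ g i) → ∀ n → 1 ℕ.≤ continuant g 1 0 (suc (suc n))
    continuant-pos g g≥1 zero = NP.m≤n+m 1 (g 0 ℕ.* 0)
    continuant-pos g g≥1 (suc n) = NP.≤-trans (NP.≤-trans (continuant-pos g g≥1 n) grow) (NP.m≤m+n _ _)
      where
      X = continuant g 1 0 (suc (suc n))
      grow : X ℕ.≤ g (suc n) ℕ.* X
      grow = subst (ℕ._≤ g (suc n) ℕ.* X) (NP.*-identityˡ X) (NP.*-monoˡ-≤ X (g≥1 (suc n)))

    -- Numerators and denominators of the Möbius map of n steps of g:
    -- x = (num (n+1) x' + num n) / (den (n+1) x' + den n).
    num den : (ℕ → ℕ) → ℕ → ℤ
    num g n = + continuant g 0 1 n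
    den g n = + continuant g 1 0 n

    -- For x = (P + √f)/Q and x' = (P' + √f)/Q', the √f-coefficient and the rational part of
    -- (P + √f)(V (P' + √f) + V' Q') - Q (U (P' + √f) + U' Q'), with ff in place of f.
    surd-part : (P Q P' Q' U U' V V' : ℤ) → ℤ
    surd-part P Q P' Q' U U' V V' = V * P + V * P' + V' * Q' - Q * U

    rational-part : (ff P Q P' Q' U U' V V' : ℤ) → ℤ
    rational-part ff P Q P' Q' U U' V V' = P * V * P' + P * V' * Q' + ff * V - Q * U * P' - Q * U' * Q'

    -- x = (U x' + U') / (V x' + V')
    MobiusRelated : (P Q P' Q' U U' V V' : ℤ) → Set
    MobiusRelated P Q P' Q' U U' V V' = surd-part P Q P' Q' U U' V V' ≡ + 0 × rational-part fz P Q P' Q' U U' V V' ≡ + 0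

    solve-left : ∀ x y z → z ≡ x + y → x ≡ z - y
    solve-left x y z refl = l x y
      where
      l : ∀ x y → x ≡ x + y - y
      l = solve-∀

    mobius-step : ∀ P Q P₂ Q₂ P₃ Q₃ a U U' V V' ff → a * Q₂ ≡ P₂ + P₃ → ff ≡ Q₂ * Q₃ + P₃ * P₃ →
        (Q₂ * surd-part P Q P₃ Q₃ (a * U + U') U (a * V + V') V
           ≡ rational-part ff P Q P₂ Q₂ U U' V V' + P₃ * surd-part P Q P₂ Q₂ U U' V V')
      × (Q₂ * rational-part ff P Q P₃ Q₃ (a * U + U') U (a * V + V') V
           ≡ P₃ * rational-part ff P Q P₂ Q₂ U U' V V' + ff * surd-part P Q P₂ Q₂ U U' V V')
    mobius-step P Q P₂ Q₂ P₃ Q₃ a U U' V V' ff aQ₂≡P₂+P₃ refl with solve-left P₂ P₃ (a * Q₂) aQ₂≡P₂+P₃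
    ... | refl = l₁ P Q Q₂ P₃ Q₃ a U U' V V' , l₂ P Q Q₂ P₃ Q₃ a U U' V V'
      where
      l₁ : ∀ P Q Q₂ P₃ Q₃ a U U' V V' → Q₂ * ((a * V + V') * P + (a * V + V') * P₃ + V * Q₃ - Q * (a * U + U'))
            ≡ (P * V * (a * Q₂ - P₃) + P * V' * Q₂ + (Q₂ * Q₃ + P₃ * P₃) * V - Q * U * (a * Q₂ - P₃) - Q * U' * Q₂)
              + P₃ * (V * P + V * (a * Q₂ - P₃) + V' * Q₂ - Q * U)
      l₁ = solve-∀
      l₂ : ∀ P Q Q₂ P₃ Q₃ a U U' V V' → Q₂ * (P * (a * V + V') * P₃ + P * V * Q₃ + (Q₂ * Q₃ + P₃ * P₃) * (a * V + V') - Q * (a * U + U') * P₃ - Q * U * Q₃)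
            ≡ P₃ * (P * V * (a * Q₂ - P₃) + P * V' * Q₂ + (Q₂ * Q₃ + P₃ * P₃) * V - Q * U * (a * Q₂ - P₃) - Q * U' * Q₂)
              + (Q₂ * Q₃ + P₃ * P₃) * (V * P + V * (a * Q₂ - P₃) + V' * Q₂ - Q * U)
      l₂ = solve-∀

    -- x_j is related to x_{j+n} by the Möbius map of the n partial quotients g = a_j, a_{j+1}, ...
    mobius-relation : ∀ j (g : ℕ → ℕ) → (∀ i → g i ≡ ak (j ℕ.+ i)) → ∀ n →
      MobiusRelated (Pz j) (Qz j) (Pz (j ℕ.+ n)) (Qz (j ℕ.+ n)) (num g (suc n)) (num g n) (den g (suc n)) (den g n)
    mobius-relation j g g≡ zero rewrite NP.+-identityʳ j = l₁ (Pz j) (Qz j) , l₂ (Pz j) (Qz j) fz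
      where
      l₁ : ∀ P Q → + 0 * P + + 0 * P + + 1 * Q - Q * + 1 ≡ + 0
      l₁ = solve-∀
      l₂ : ∀ P Q ff → P * + 0 * P + P * + 1 * Q + ff * + 0 - Q * + 1 * P - Q * + 0 * Q ≡ + 0
      l₂ = solve-∀
    mobius-relation j g g≡ (suc n) rewrite NP.+-suc j n =
      Q-cancel k _ _ (trans (cong (Qz k *_) (cong₂ (λ u v → surd-part P Q P₃ Q₃ u U v V) (rec 0 1) (rec 1 0)))
                            (trans (proj₁ step) (vanish (proj₂ IH) (proj₁ IH)))) ,
      Q-cancel k _ _ (trans (cong (Qz k *_) (cong₂ (λ u v → rational-part fz P Q P₃ Q₃ u U v V) (rec 0 1) (rec 1 0)))
                            (trans (proj₂ step) (vanish′ (proj₂ IH) (proj₁ IH))))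
      where
      k = j ℕ.+ n
      P = Pz j
      Q = Qz j
      P₃ = Pz (suc k)
      Q₃ = Qz (suc k)
      U = num g (suc n)
      V = den g (suc n)
      IH = mobius-relation j g g≡ n
      step = mobius-step P Q (Pz k) (Qz k) P₃ Q₃ (az k) U (num g n) V (den g n) fz (P-sumz k) (Q-normz k)
      rec : ∀ x₀ x₁ → + continuant g x₀ x₁ (suc (suc n)) ≡ az k * + continuant g x₀ x₁ (suc n) + + continuant g x₀ x₁ n
      rec x₀ x₁ = trans (pos-+ (g n ℕ.* continuant g x₀ x₁ (suc n)) _)
                        (cong (_+ + continuant g x₀ x₁ n) (trans (pos-* (g n) _) (cong (λ a → + a * + continuant g x₀ x₁ (suc n)) (g≡ n))))
      vanish : ∀ {x y} → x ≡ + 0 → y ≡ + 0 → x + P₃ * y ≡ Qz k * + 0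
      vanish refl refl = l P₃ (Qz k)
        where
        l : ∀ a b → + 0 + a * + 0 ≡ b * + 0
        l = solve-∀
      vanish′ : ∀ {x y} → x ≡ + 0 → y ≡ + 0 → P₃ * x + fz * y ≡ Qz k * + 0
      vanish′ refl refl = l P₃ fz (Qz k)
        where
        l : ∀ a b c → a * + 0 + b * + 0 ≡ c * + 0
        l = solve-∀

    fixed-linear : ∀ P Q U U' V V' → MobiusRelated P Q P Q U U' V V' → (+ 2 * V) * P ≡ Q * (U - V')
    fixed-linear P Q U U' V V' (surd≡0 , _) = i-j≡0⇒i≡j _ _ (trans (l P Q U V V') surd≡0)
      where
      l : ∀ P Q U V V' → (+ 2 * V) * P - Q * (U - V') ≡ V * P + V * P + V' * Q - Q * U
      l = solve-∀

    fixed-quadratic : ∀ P Q U U' V V' → MobiusRelated P Q P Q U U' V V' → V * (fz - P * P) ≡ U' * (Q * Q)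
    fixed-quadratic P Q U U' V V' (surd≡0 , rational≡0) =
      i-j≡0⇒i≡j _ _ (trans (l P Q U U' V V' fz) (trans (cong₂ (λ x y → x - P * y) rational≡0 surd≡0) (l₀ P)))
      where
      l : ∀ P Q U U' V V' ff → V * (ff - P * P) - U' * (Q * Q)
            ≡ (P * V * P + P * V' * Q + ff * V - Q * U * P - Q * U' * Q) - P * (V * P + V * P + V' * Q - Q * U)
      l = solve-∀
      l₀ : ∀ P → + 0 - P * + 0 ≡ + 0
      l₀ = solve-∀

    -- The map (with V ≥ 1) has at most one fixed point (P + √f)/Q with Q ≥ 1: the linear
    -- relations give P₁ Q₂ = P₂ Q₁, and then the quadratic ones give f Q₂² = f Q₁².
    fixed-point-unique : ∀ P₁ Q₁ P₂ Q₂ U U' (Vn : ℕ) V' → 1 ℕ.≤ f → 1 ℕ.≤ Q₂ → 1 ℕ.≤ Vn →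
      MobiusRelated (+ P₁) (+ Q₁) (+ P₁) (+ Q₁) U U' (+ Vn) V' →
      MobiusRelated (+ P₂) (+ Q₂) (+ P₂) (+ Q₂) U U' (+ Vn) V' → P₁ ≡ P₂ × Q₁ ≡ Q₂
    fixed-point-unique P₁ Q₁ P₂ Q₂ U U' (suc v) V' 1≤f 1≤Q₂ _ fixed₁ fixed₂ = P₁≡P₂ , Q₁≡Q₂
      where
      open ≡-Reasoning
      V = + suc v
      cross : + P₁ * + Q₂ ≡ + P₂ * + Q₁
      cross = *-cancelˡ-≡ (+ 2 * V) _ _ (begin
          (+ 2 * V) * (+ P₁ * + Q₂)   ≡⟨ sym (*-assoc (+ 2 * V) (+ P₁) (+ Q₂)) ⟩
          (+ 2 * V) * + P₁ * + Q₂     ≡⟨ cong (_* + Q₂) (fixed-linear (+ P₁) (+ Q₁) U U' V V' fixed₁) ⟩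
          + Q₁ * (U - V') * + Q₂      ≡⟨ l (+ Q₁) (U - V') (+ Q₂) ⟩
          + Q₂ * (U - V') * + Q₁      ≡⟨ cong (_* + Q₁) (sym (fixed-linear (+ P₂) (+ Q₂) U U' V V' fixed₂)) ⟩
          (+ 2 * V) * + P₂ * + Q₁     ≡⟨ *-assoc (+ 2 * V) (+ P₂) (+ Q₁) ⟩
          (+ 2 * V) * (+ P₂ * + Q₁)   ∎)
        where
        l : ∀ a b c → a * b * c ≡ c * b * a
        l = solve-∀
      fQ₂²≡fQ₁² : V * (fz * (+ Q₂ * + Q₂)) ≡ V * (fz * (+ Q₁ * + Q₁))
      fQ₂²≡fQ₁² = begin
          V * (fz * (+ Q₂ * + Q₂))
        ≡⟨ l₁ V fz (+ P₁) (+ Q₂) ⟩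
          V * (fz - + P₁ * + P₁) * (+ Q₂ * + Q₂) + V * ((+ P₁ * + Q₂) * (+ P₁ * + Q₂))
        ≡⟨ cong₂ (λ x y → x * (+ Q₂ * + Q₂) + V * (y * y)) (fixed-quadratic (+ P₁) (+ Q₁) U U' V V' fixed₁) cross ⟩
          U' * (+ Q₁ * + Q₁) * (+ Q₂ * + Q₂) + V * ((+ P₂ * + Q₁) * (+ P₂ * + Q₁))
        ≡⟨ l₂ U' (+ Q₁) (+ Q₂) V ((+ P₂ * + Q₁) * (+ P₂ * + Q₁)) ⟩
          U' * (+ Q₂ * + Q₂) * (+ Q₁ * + Q₁) + V * ((+ P₂ * + Q₁) * (+ P₂ * + Q₁))
        ≡⟨ cong (λ x → x * (+ Q₁ * + Q₁) + V * ((+ P₂ * + Q₁) * (+ P₂ * + Q₁))) (sym (fixed-quadratic (+ P₂) (+ Q₂) U U' V V' fixed₂)) ⟩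
          V * (fz - + P₂ * + P₂) * (+ Q₁ * + Q₁) + V * ((+ P₂ * + Q₁) * (+ P₂ * + Q₁))
        ≡⟨ sym (l₁ V fz (+ P₂) (+ Q₁)) ⟩
          V * (fz * (+ Q₁ * + Q₁)) ∎
        where
        l₁ : ∀ V ff P Q → V * (ff * (Q * Q)) ≡ V * (ff - P * P) * (Q * Q) + V * ((P * Q) * (P * Q))
        l₁ = solve-∀
        l₂ : ∀ U' Q₁ Q₂ V x → U' * (Q₁ * Q₁) * (Q₂ * Q₂) + V * x ≡ U' * (Q₂ * Q₂) * (Q₁ * Q₁) + V * x
        l₂ = solve-∀
      cancel-f : fz * (+ Q₂ * + Q₂) ≡ fz * (+ Q₁ * + Q₁) → + Q₂ * + Q₂ ≡ + Q₁ * + Q₁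
      cancel-f = *-cancelˡ-≡ fz _ _ {{ℕ.>-nonZero 1≤f}}
      Q₁≡Q₂ : Q₁ ≡ Q₂
      Q₁≡Q₂ = sym (square-injective Q₂ Q₁ (+-injective (trans (pos-* Q₂ Q₂)
                (trans (cancel-f (*-cancelˡ-≡ V _ _ fQ₂²≡fQ₁²)) (sym (pos-* Q₁ Q₁))))))
      P₁≡P₂ : P₁ ≡ P₂
      P₁≡P₂ = cancel-*ʳ P₁ P₂ Q₂ 1≤Q₂ (subst (λ z → P₁ ℕ.* Q₂ ≡ P₂ ℕ.* z) Q₁≡Q₂
                (+-injective (trans (pos-* P₁ Q₂) (trans cross (sym (pos-* P₂ Q₁))))))

    step-from-unit : ∀ P → next (P , 1) ≡ (r , (f ℕ.∸ r ℕ.* r) div 1)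
    step-from-unit P = cong (λ p → p , (f ℕ.∸ p ℕ.* p) div 1) P'≡r
      where
      P'≡r : (P ℕ.+ r) div 1 ℕ.* 1 ℕ.∸ P ≡ r
      P'≡r = trans (cong (λ z → z ℕ.* 1 ℕ.∸ P) (n/1≡n (P ℕ.+ r)))
               (trans (cong (ℕ._∸ P) (NP.*-identityʳ (P ℕ.+ r))) (NP.m+n∸m≡n P r))

    PQ-1 : PQ f 1 ≡ (r , (f ℕ.∸ r ℕ.* r) div 1)
    PQ-1 = step-from-unit 0

    PQ-period : ∀ K → Qk K ≡ 1 → ∀ j → PQ f (suc j ℕ.+ K) ≡ PQ f (suc j)
    PQ-period K Q≡1 zero = trans (cong (λ q → next (Pk K , q)) Q≡1) (trans (step-from-unit (Pk K)) (sym PQ-1))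
    PQ-period K Q≡1 (suc j) = cong next (PQ-period K Q≡1 j)

    unit-Q-period : ∀ K → 1 ℕ.≤ K → Qk K ≡ 1 → IsPeriod f K
    unit-Q-period K 1≤K Q≡1 = 1≤K , λ { (suc j) _ → cong a-of (PQ-period K Q≡1 j) }

    -- A period L of the partial quotients is a period of (P, Q), given some K ≥ 1 with
    -- Q_K = 1: x_1 and x_{L+1} have the same expansion, so both are fixed points of the
    -- K-step map of a_1, a_2, ... .
    period-of-PQ : ∀ K L → 1 ℕ.≤ K → Qk K ≡ 1 → IsPeriod f L → Pk 1 ≡ Pk (suc L) × Qk 1 ≡ Qk (suc L)
    period-of-PQ (suc K′) L 1≤K Q≡1 (_ , a-period) =
      fixed-point-unique (Pk 1) (Qk 1) (Pk (suc L)) (Qk (suc L))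
        (num g (suc K)) (num g K) (continuant g 1 0 (suc K)) (den g K) 1≤f (Q≥1 (suc L))
        (continuant-pos g (λ i → a≥1 (suc i)) K′) (back-to 1 0 refl related₁) (back-to (suc L) L refl related₂)
      where
      K = suc K′
      g : ℕ → ℕ
      g i = ak (suc i)
      1≤f : 1 ℕ.≤ f
      1≤f = NP.≤-trans 1≤r (NP.≤-trans (NP.m≤m*n r r {{ℕ.>-nonZero 1≤r}}) (NP.<⇒≤ r²<f))
      related₁ = mobius-relation 1 g (λ _ → refl) K
      related₂ = mobius-relation (suc L) g (λ i → sym (trans (cong (cfA f) (cong suc (NP.+-comm L i)))
                                                         (a-period (suc i) (ℕ.s≤s ℕ.z≤n)))) K
      back-to : ∀ j j′ → j ≡ suc j′ →
        MobiusRelated (Pz j) (Qz j) (Pz (j ℕ.+ K)) (Qz (j ℕ.+ K)) (num g (suc K)) (num g K) (den g (suc K)) (den g K) →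
        MobiusRelated (Pz j) (Qz j) (Pz j) (Qz j) (num g (suc K)) (num g K) (den g (suc K)) (den g K)
      back-to _ j′ refl = subst (λ s → MobiusRelated (Pz (suc j′)) (Qz (suc j′)) (+ proj₁ s) (+ proj₂ s)
                                   (num g (suc K)) (num g K) (den g (suc K)) (den g K))
                                (PQ-period K Q≡1 j′)

    -- From f = Q_L Q_{L+1} + P_{L+1}² = Q_L Q_1 + P_1² = Q_0 Q_1 + P_1² and Q_0 = 1 we get Q_L = 1;
    -- then r < P_L + Q_L gives P_L = r, and f = Q_{L-1} Q_L + P_L² = Q_0 Q_1 + P_1² gives Q_{L-1} = Q_1.
    record PeriodEnd (L′ : ℕ) : Set where
      field
        Q≡1 : Qk (suc L′) ≡ 1
        P≡r : Pk (suc L′) ≡ r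
        Q-before : Qk L′ ≡ Qk 1

    period-end : ∀ L′ → Pk 1 ≡ Pk (suc (suc L′)) × Qk 1 ≡ Qk (suc (suc L′)) → PeriodEnd L′
    period-end L′ (P₁≡ , Q₁≡) = record { Q≡1 = Q≡1 ; P≡r = P≡r ; Q-before = Q-before }
      where
      L = suc L′
      P₁≡r : Pk 1 ≡ r
      P₁≡r = cong proj₁ PQ-1
      Q≡1 : Qk L ≡ 1
      Q≡1 = cancel-*ʳ (Qk L) 1 (Qk 1) (Q≥1 1)
              (NP.+-cancelʳ-≡ (Pk 1 ℕ.* Pk 1) (Qk L ℕ.* Qk 1) (1 ℕ.* Qk 1)
                (trans (trans (cong₂ (λ q p → Qk L ℕ.* q ℕ.+ p ℕ.* p) Q₁≡ P₁≡) (Q-norm L)) (sym (Q-norm 0))))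
      P≡r : Pk L ≡ r
      P≡r = NP.≤-antisym (P≤r L) (NP.≤-pred (subst (r ℕ.<_) (trans (cong (Pk L ℕ.+_) Q≡1) (NP.+-comm (Pk L) 1)) (r<P+Q L′)))
      Q-before : Qk L′ ≡ Qk 1
      Q-before = trans (sym (NP.*-identityʳ (Qk L′)))
                   (trans (NP.+-cancelʳ-≡ (r ℕ.* r) (Qk L′ ℕ.* 1) (1 ℕ.* Qk 1)
                            (trans (trans (cong₂ (λ q p → Qk L′ ℕ.* q ℕ.+ p ℕ.* p) (sym Q≡1) (sym P≡r)) (Q-norm L′))
                                   (trans (sym (Q-norm 0)) (cong (λ p → 1 ℕ.* Qk 1 ℕ.+ p ℕ.* p) P₁≡r))))
                          (NP.*-identityˡ (Qk 1)))

  -- Symmetry of the period: running the algorithm backwards from the end of the period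
  -- retraces it, so the partial quotients form a palindrome, and the convergent at the
  -- end of the period splits as a product of continuants around any inner index.
  module Symmetry where
    open Reduction
    open Periodicity using (PQ-1)
    open import Data.Nat
    open import Data.Nat.Properties
    open import Data.Product using (_,_; proj₁)
    open import Relation.Binary.PropositionalEquality
    open import Data.Nat.Tactic.RingSolver using (solve-∀)
    open Arithmetic using (div-unique; div-exact)

    reverse-quotient : ∀ k′ → a-of (Pk (suc (suc k′)) , Qk (suc k′)) ≡ ak (suc k′)
    reverse-quotient k′ = div-unique (Pk (suc k) + r) (Qk k) (ak k) (Q≥1 k)
        (subst (_≤ Pk (suc k) + r) (P-sum k) (+-monoʳ-≤ (Pk (suc k)) (P≤r k)))
        (subst (Pk (suc k) + r <_) (trans (sym (+-assoc (Pk (suc k)) (Pk k) (Qk k))) (cong (_+ Qk k) (P-sum k)))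
               (+-monoʳ-< (Pk (suc k)) (r<P+Q k′)))
      where
      k = suc k′

    reverse-step : ∀ k′ → next (Pk (suc (suc k′)) , Qk (suc k′)) ≡ (Pk (suc k′) , Qk k′)
    reverse-step k′ = cong₂ _,_ P-back (trans (cong (λ p → (f ∸ p * p) div Qk k) P-back) Q-back)
      where
      k = suc k′
      P-back : a-of (Pk (suc k) , Qk k) * Qk k ∸ Pk (suc k) ≡ Pk k
      P-back = trans (cong (λ a → a * Qk k ∸ Pk (suc k)) (reverse-quotient k′))
                 (trans (cong (_∸ Pk (suc k)) (sym (P-sum k))) (m+n∸m≡n (Pk (suc k)) (Pk k)))
      Q-back : (f ∸ Pk k * Pk k) div Qk k ≡ Qk k′
      Q-back = trans (cong (_div Qk k) (trans (cong (_∸ Pk k * Pk k) (sym (Q-norm k′)))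
                                              (trans (m+n∸n≡m (Qk k′ * Qk k) (Pk k * Pk k)) (*-comm (Qk k′) (Qk k)))))
                     (div-exact (Qk k′) (Qk k) (Q≥1 k))

    module Palindrome (L′ : ℕ) (P≡r : Pk (suc L′) ≡ r) (Q-before : Qk L′ ≡ Qk 1) where
      mirror : ∀ i j → i + j ≡ L′ → PQ f (suc i) ≡ (Pk (suc j) , Qk j)
      mirror zero j refl = cong₂ _,_ (trans (cong proj₁ PQ-1) (sym P≡r)) (sym Q-before)
      mirror (suc i) j e = trans (cong next (mirror i (suc j) (trans (+-suc i j) e))) (reverse-step j)

      palindrome : ∀ i j → suc i + suc j ≡ suc L′ → ak (suc i) ≡ ak (suc j)
      palindrome i j e = trans (cong a-of (mirror i (suc j) (suc-injective e))) (reverse-quotient j)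

      continuant-split : (X : ℕ → ℕ) → (∀ n → X (suc (suc n)) ≡ ak n * X (suc n) + X n) →
        ∀ j t → j + t ≡ L′ → X (suc (suc L′)) ≡ Bₛ f (suc (suc j)) * X (suc (suc t)) + Bₛ f (suc j) * X (suc t)
      continuant-split X X-rec zero t refl = l (cfA f 0) (X (suc (suc t))) (X (suc t))
        where
        l : ∀ a x y → x ≡ (a * 0 + 1) * x + 0 * y
        l = solve-∀
      continuant-split X X-rec (suc j) t e = begin
          X (suc (suc L′))                                          ≡⟨ continuant-split X X-rec j (suc t) (trans (+-suc j t) e) ⟩
          b₂ * X (suc (suc (suc t))) + b₁ * X (suc (suc t))         ≡⟨ cong (λ z → b₂ * z + b₁ * X (suc (suc t))) (X-rec (suc t)) ⟩
          b₂ * (ak (suc t) * X (suc (suc t)) + X (suc t)) + b₁ * X (suc (suc t))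
                                                                    ≡⟨ cong (λ a → b₂ * (a * X (suc (suc t)) + X (suc t)) + b₁ * X (suc (suc t))) (sym mirrored) ⟩
          b₂ * (ak (suc j) * X (suc (suc t)) + X (suc t)) + b₁ * X (suc (suc t))
                                                                    ≡⟨ l b₂ b₁ (ak (suc j)) (X (suc (suc t))) (X (suc t)) ⟩
          (ak (suc j) * b₂ + b₁) * X (suc (suc t)) + b₂ * X (suc t) ∎
        where
        open ≡-Reasoning
        b₂ = Bₛ f (suc (suc j))
        b₁ = Bₛ f (suc j)
        mirrored : ak (suc j) ≡ ak (suc t)
        mirrored = palindrome j t (cong suc (trans (+-suc j t) e))
        l : ∀ b₂ b₁ a x₂ x₁ → b₂ * (a * x₂ + x₁) + b₁ * x₂ ≡ (a * b₂ + b₁) * x₂ + b₂ * x₁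
        l = solve-∀

  module EvenPeriod (M′ : ℕ) (minimal : PeriodLength f (suc M′ ℕ.+ suc M′))
                    (c h : ℕ) (fundamental : FundamentalSol f c h) where
    open Reduction
    open Norms using (pell-at; sign-even)
    open Growth
    open Legendre using (legendre; module ConvergentIndex)
    open Periodicity using (unit-Q-period; period-of-PQ; PeriodEnd; period-end)
    open Symmetry
    open import Data.Nat
    open import Data.Nat.Properties
    open import Data.Product using (_×_; _,_; proj₁; proj₂)
    open import Relation.Binary.PropositionalEquality

    M L′ : ℕ
    M = suc M′
    L′ = M′ + M     -- the period is L = L′ + 1 = M + M

    -- Legendre places (c, h) at some K with Q_K = 1, which is a period, so L ≤ K.
    open ConvergentIndex (legendre c h (proj₂ (proj₂ (proj₁ fundamental))) (proj₁ (proj₂ (proj₁ fundamental))))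

    L≤K : suc L′ ≤ K
    L≤K = proj₂ minimal K (unit-Q-period K 1≤K Q≡1)

    end : PeriodEnd L′
    end = period-end L′ (period-of-PQ K (suc L′) 1≤K Q≡1 (proj₁ minimal))

    -- (A_{L-1}, B_{L-1}) solves Pell's equation since L is even and Q_L = 1; minimality of
    -- (c, h) and monotonicity of the convergents up to K give equality.
    c≡A×h≡B : c ≡ Aₛ f (suc (suc L′)) × h ≡ Bₛ f (suc (suc L′))
    c≡A×h≡B = ≤-antisym (proj₁ minimum) (subst (Aₛ f (suc (suc L′)) ≤_) (sym x≡A) (A-mono L≤K))
            , ≤-antisym (proj₂ minimum) (subst (Bₛ f (suc (suc L′)) ≤_) (sym y≡B) (B-mono L≤K))
      where
      pell : Aₛ f (suc (suc L′)) * Aₛ f (suc (suc L′)) ≡ f * (Bₛ f (suc (suc L′)) * Bₛ f (suc (suc L′))) + 1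
      pell = pell-at (suc L′) (PeriodEnd.Q≡1 end) (sign-even M)
      minimum : c ≤ Aₛ f (suc (suc L′)) × h ≤ Bₛ f (suc (suc L′))
      minimum = proj₂ fundamental _ _ (A-pos (suc L′) (s≤s z≤n) , B-pos (suc L′) (s≤s z≤n) , pell)

    open Palindrome L′ (PeriodEnd.P≡r end) (PeriodEnd.Q-before end)

    middle : M + M′ ≡ L′
    middle = sym (+-suc M′ M′)

    c-split : c ≡ Bₛ f (suc (suc M)) * Aₛ f (suc M) + Bₛ f (suc M) * Aₛ f M
    c-split = trans (proj₁ c≡A×h≡B) (continuant-split (Aₛ f) (λ _ → refl) M M′ middle)

    h-split : h ≡ Bₛ f (suc (suc M)) * Bₛ f (suc M) + Bₛ f (suc M) * Bₛ f M
    h-split = trans (proj₂ c≡A×h≡B) (continuant-split (Bₛ f) (λ _ → refl) M M′ middle)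

open import Data.Nat using (_+_; _*_; _∸_; _≤_; _%_)
open import Relation.Binary.PropositionalEquality using (_≡_; refl; subst)

-- With m = 2n + 1 odd, the split at the middle index m together with the determinant
-- A_{m-2} B_{m-1} = A_{m-1} B_{m-2} + 1 gives h A_{m-1} = (c - 1) B_{m-1}.
lemma6 : (f m : ℕ) → 1 ≤ f → NonSquare f → PeriodLength f (2 * m) → (2 * m) % 4 ≡ 2 →
    (c h : ℕ) → FundamentalSol f c h →
    h * convA f (m ∸ 1) ≡ (c ∸ 1) * convB f (m ∸ 1)
lemma6 f m 1≤f nonsquare period 2m%4≡2 c h fundamental with Arithmetic.odd-half m 2m%4≡2
... | n , refl = Arithmetic.split-identity (Bₛ f (suc (suc M))) (Aₛ f (suc M)) (Bₛ f (suc M)) (Aₛ f M) (Bₛ f M)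
                   c h c-split h-split (determinant-odd n)
  where
  open import Data.Nat.Properties using (≤∧≢⇒<)
  open import Data.Nat.Tactic.RingSolver using (solve-∀)
  r²<f : isqrt f * isqrt f ℕ.< f
  r²<f = ≤∧≢⇒< (IntegerSqrt.isqrt-sq f) (nonsquare (isqrt f))
  open Theory f r²<f (IntegerSqrt.isqrt-pos f 1≤f)
  open Norms using (determinant-odd)
  double : ∀ n → 2 * suc (n + n) ≡ suc (n + n) + suc (n + n)
  double = solve-∀
  open EvenPeriod (n + n) (subst (PeriodLength f) (double n) period) c h fundamental
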